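{- Let $G$ be a block graph and let $\alpha=(v_1,v_2,\dots,v_n)$ be a block elimination ordering of $G$. If $B$ and $B'$ are two distinct blocks of $G$ with $v_i\in V(B)\cap V(B')$, then either $F(u)=v_i$ for all $u\in V(B)\setminus\{v_i\}$, or $F(u)=v_i$ for all $u\in V(B')\setminus\{v_i\}$.
   Context: All graphs are finite, simple and connected. A block of a graph is a maximal induced subgraph without a cut vertex; a block graph is a connected graph every block of which is complete. A block elimination ordering (BEO) of $G$ is an ordering $(v_1,\dots,v_n)$ of $V(G)$ such that for all $i<j<k\le n$, if $v_iv_j\in E$ and $v_iv_k\in E$ then $v_jv_k\in E$. With respect to such an ordering, for $i\ne n$ define $F(v_i)=v_j$ where $j=\max\{k : v_iv_k\in E\}$, and $F(v_n)=v_n$. -}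

module Defs where

open import Data.Nat using (ℕ; zero; suc)
open import Data.Fin using (Fin; toℕ; _<_)
open import Data.Fin.Subset using (Subset; _∈_; _⊆_; ⊤; _-_)
open import Data.Bool using (Bool; true; false; if_then_else_)
open import Data.List using (List; foldl)
open import Data.Product using (_×_; Σ; ∃)
open import Relation.Binary.PropositionalEquality using (_≡_; _≢_)
open import Data.List using (allFin)
open import Data.Nat.Base using () renaming (_≡ᵇ_ to _==_)

Graph : ℕ → Set
Graph n = Fin n → Fin n → Bool

Adj : ∀ {n} → Graph n → Fin n → Fin n → Set
Adj G x y = G x y ≡ true

IsSimple : ∀ {n} → Graph n → Set
IsSimple G = (∀ x y → G x y ≡ G y x) × (∀ x → G x x ≡ false)

data WalkIn {n} (G : Graph n) (S : Subset n) : Fin n → Fin n → Set where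
  here : ∀ {x} → x ∈ S → WalkIn G S x x
  step : ∀ {x y z} → x ∈ S → Adj G x y → WalkIn G S y z → WalkIn G S x z

-- The induced subgraph G[S] is connected (vacuous for empty S).
ConnectedOn : ∀ {n} → Graph n → Subset n → Set
ConnectedOn {n} G S = ∀ (a b : Fin n) → a ∈ S → b ∈ S → WalkIn G S a b

IsConnected : ∀ {n} → Graph n → Set
IsConnected {n} G = ∀ (a b : Fin n) → WalkIn G ⊤ a b

_─_ : ∀ {n} → Subset n → Fin n → Subset n
(S ─ x) = S - x

NoCutVertex : ∀ {n} → Graph n → Subset n → Set
NoCutVertex G S = ConnectedOn G S × (∀ x → x ∈ S → ConnectedOn G (S ─ x))

IsBlock : ∀ {n} → Graph n → Subset n → Set
IsBlock {n} G S =
  (∃ λ (x : Fin n) → x ∈ S) × NoCutVertex G S ×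
  (∀ T → S ⊆ T → NoCutVertex G T → T ≡ S)

IsBlockGraph : ∀ {n} → Graph n → Set
IsBlockGraph {n} G = IsConnected G ×
  (∀ B → IsBlock G B → ∀ (x y : Fin n) → x ∈ B → y ∈ B → x ≢ y → Adj G x y)

-- The identity ordering (v_1,...,v_n) = (0,...,n-1) is a block elimination
-- ordering (any ordering can be realised by relabelling vertices).
IsBEO : ∀ {n} → Graph n → Set
IsBEO {n} G = ∀ (i j k : Fin n) → i < j → j < k →
  Adj G i j → Adj G i k → Adj G j k

-- F(v): the neighbour of v with the largest index (for v not last);
-- F(v_n) = v_n.  Folding over the vertices in increasing order, the last
-- neighbour seen is the maximal one.
F : ∀ {m} → Graph (suc m) → Fin (suc m) → Fin (suc m)
F {m} G u = if toℕ u == m then u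
            else foldl (λ acc k → if G u k then k else acc) u (allFin (suc m))

module Submission where

-- In a block graph every block is a clique, and two facts about
-- clique blocks drive the argument:
--   (absorption)  a vertex adjacent to two distinct vertices of a clique
--                 block B lies in B, and
--   (separation)  two distinct clique blocks share at most one vertex.
-- Both follow from maximality of blocks, because the union of two cliques
-- sharing two distinct vertices is connected and has no cut vertex.
-- For a block elimination ordering, the later neighbours of a vertex are
-- pairwise adjacent.  Hence, if v is the largest vertex of a clique block B,
-- every u ∈ B - v has v as its largest neighbour (a larger neighbour w would
-- be adjacent to u and v and so absorbed into B), i.e. F(u) = v.
-- Finally, if v ∈ B ∩ B′ and some u ∈ B comes after v, then no u′ ∈ B′
-- comes after v: u and u′ would be adjacent later neighbours of v, so u′
-- would be absorbed into B, and then B, B′ would share v and u′.  So v is the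
-- largest vertex of B or of B′, which gives the theorem.

open import Defs
open import Data.Nat using (ℕ; suc)
open import Data.Nat using (_≡ᵇ_)
open import Data.Fin using (Fin)
open import Data.Fin.Subset using (Subset; _∈_)
open import Data.Sum using (_⊎_)
open import Relation.Binary.PropositionalEquality using (_≡_; _≢_)

open import Data.Bool using (Bool; true; false; if_then_else_; T)
open import Data.Empty using (⊥-elim)
open import Data.Fin using (toℕ; _<_; _≟_)
import Data.Fin.Properties as FinP
open import Data.Fin.Subset using (_∪_; ⁅_⁆; _-_)
open import Data.Fin.Subset.Properties
  using (x∈⁅x⁆; x∈⁅y⁆⇒x≡y; p⊆p∪q; x∈p∪q⁻; x∈p∪q⁺; p─q⊆p; ∪-comm; x∈p∧x≢y⇒x∈p-y; _∈?_)
open import Data.List using (List; []; _∷_; foldl; allFin)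
open import Data.List.Membership.Propositional using () renaming (_∈_ to _∈ₗ_)
open import Data.List.Membership.Propositional.Properties using (∈-allFin)
import Data.List.Relation.Unary.All as All
open import Data.List.Relation.Unary.Any using (here; there)
open import Data.List.Relation.Unary.AllPairs using (AllPairs; _∷_)
open import Data.List.Relation.Unary.AllPairs.Properties using (tabulate⁺-<)
open import Data.Nat.Properties using (≡ᵇ⇒≡; <-irrefl; <-≤-trans; ≮⇒≥)
open import Data.Product using (∃; _×_; _,_)
open import Data.Sum using (inj₁; inj₂)
open import Data.Unit using (tt)
open import Relation.Binary using (Rel; tri<; tri≈; tri>)
open import Relation.Binary.PropositionalEquality using (refl; sym; trans; subst; module ≡-Reasoning)
open import Relation.Nullary using (¬_; Dec; yes; no)
open import Relation.Nullary.Decidable using (_×-dec_)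
open import Function using (_∘_)

keepIf : ∀ {a} {A : Set a} → (A → Bool) → A → A → A
keepIf p acc k = if p k then k else acc

keepIf-none : ∀ {a} {A : Set a} (p : A → Bool) acc (xs : List A) →
  (∀ x → x ∈ₗ xs → p x ≡ false) → foldl (keepIf p) acc xs ≡ acc
keepIf-none p acc []       none = refl
keepIf-none p acc (x ∷ xs) none
  rewrite none x (here refl) = keepIf-none p acc xs (λ y y∈ → none y (there y∈))

keepIf-last : ∀ {a ℓ} {A : Set a} {R : Rel A ℓ} (p : A → Bool) acc (xs : List A) →
  AllPairs R xs → ∀ {v} → v ∈ₗ xs → p v ≡ true →
  (∀ w → w ∈ₗ xs → p w ≡ true → ¬ R v w) → foldl (keepIf p) acc xs ≡ v
keepIf-last p acc (x ∷ xs) (x<xs ∷ _) (here refl) px≡t noLater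
  rewrite px≡t = keepIf-none p x xs notAfter
  where
  notAfter : ∀ w → w ∈ₗ xs → p w ≡ false
  notAfter w w∈ with p w in pw
  ... | false = refl
  ... | true  = ⊥-elim (noLater w (there w∈) pw (All.lookup x<xs w∈))
keepIf-last p acc (x ∷ xs) (_ ∷ sorted) (there v∈xs) pv noLater =
  keepIf-last p (keepIf p acc x) xs sorted v∈xs pv (λ w w∈ → noLater w (there w∈))

F-largestNeighbour : ∀ {m} (G : Graph (suc m)) (u v : Fin (suc m)) →
  u < v → Adj G u v → (∀ w → Adj G u w → ¬ v < w) → F G u ≡ v
F-largestNeighbour {m} G u v u<v uv noLater = trans notLast largest
  where
  fold : Fin (suc m)
  fold = foldl (keepIf (G u)) u (allFin (suc m))
  u≢m : toℕ u ≢ m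
  u≢m u≡m = <-irrefl u≡m (<-≤-trans u<v (FinP.toℕ≤pred[n] v))
  notLast : F G u ≡ fold
  notLast with toℕ u ≡ᵇ m in e
  ... | false = refl
  ... | true  = ⊥-elim (u≢m (≡ᵇ⇒≡ (toℕ u) m (subst T (sym e) tt)))
  -- allFin lists the vertices in increasing order.
  largest : fold ≡ v
  largest = keepIf-last {R = _<_} (G u) u (allFin (suc m)) (tabulate⁺-< {f = λ i → i} (λ i<j → i<j))
              (∈-allFin v) uv (λ w _ → noLater w)

module _ {n} (G : Graph n) where

  IsClique : (Fin n → Set) → Set
  IsClique P = ∀ x y → P x → P y → x ≢ y → Adj G x y

  Near : Fin n → Fin n → Set
  Near x y = x ≡ y ⊎ Adj G x y

  clique-near : ∀ {P} → IsClique P → ∀ x y → P x → P y → Near x y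
  clique-near cl x y px py with x ≟ y
  ... | yes x≡y = inj₁ x≡y
  ... | no  x≢y = inj₂ (cl x y px py x≢y)

  near-step : ∀ {V x y b} → x ∈ V → Near x y → WalkIn G V y b → WalkIn G V x b
  near-step x∈V (inj₁ refl) walk = walk
  near-step x∈V (inj₂ xy)   walk = step x∈V xy walk

  twoCliques-connected : (V : Subset n) (P Q : Fin n → Set) →
    (∀ x → x ∈ V → P x ⊎ Q x) → IsClique P → IsClique Q →
    (r : Fin n) → r ∈ V → P r → Q r → ConnectedOn G V
  twoCliques-connected V P Q cover clP clQ r r∈V Pr Qr a b a∈V b∈V
    with cover a a∈V | cover b b∈V
  ... | inj₁ Pa | inj₁ Pb = near-step a∈V (clique-near clP a b Pa Pb) (here b∈V)
  ... | inj₂ Qa | inj₂ Qb = near-step a∈V (clique-near clQ a b Qa Qb) (here b∈V)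
  ... | inj₁ Pa | inj₂ Qb = near-step a∈V (clique-near clP a r Pa Pr)
                              (near-step r∈V (clique-near clQ r b Qr Qb) (here b∈V))
  ... | inj₂ Qa | inj₁ Pb = near-step a∈V (clique-near clQ a r Qa Qr)
                              (near-step r∈V (clique-near clP r b Pr Pb) (here b∈V))

  -- The union U of two cliques sharing two distinct vertices p, q has no cut
  -- vertex: after deleting any z, one of p, q remains as a common vertex.
  twoCliques-noCutVertex : (U : Subset n) (P Q : Fin n → Set) →
    (∀ x → x ∈ U → P x ⊎ Q x) → (∀ x → P x → x ∈ U) →
    IsClique P → IsClique Q →
    (p q : Fin n) → p ≢ q → P p → Q p → P q → Q q → NoCutVertex G U
  twoCliques-noCutVertex U P Q cover P⊆U clP clQ p q p≢q Pp Qp Pq Qq =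
    twoCliques-connected U P Q cover clP clQ p (P⊆U p Pp) Pp Qp , deleted
    where
    deleted : ∀ z → z ∈ U → ConnectedOn G (U ─ z)
    deleted z _ = survivor (p ≟ z)
      where
      cover′ : ∀ x → x ∈ U - z → P x ⊎ Q x
      cover′ x x∈ = cover x (p─q⊆p U ⁅ z ⁆ x∈)
      survivor : Dec (p ≡ z) → ConnectedOn G (U ─ z)
      survivor (no p≢z)   = twoCliques-connected (U - z) P Q cover′ clP clQ
                              p (x∈p∧x≢y⇒x∈p-y (P⊆U p Pp) p≢z) Pp Qp
      survivor (yes refl) = twoCliques-connected (U - z) P Q cover′ clP clQ
                              q (x∈p∧x≢y⇒x∈p-y (P⊆U q Pq) (λ q≡p → p≢q (sym q≡p))) Pq Qq

  -- A clique block B swallows any vertex set X lying in a clique Q that meets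
  -- B in two distinct vertices: B ∪ X has no cut vertex, so by maximality
  -- of B it equals B.
  block-absorbs-clique : (B X : Subset n) (Q : Fin n → Set) →
    IsBlock G B → IsClique (_∈ B) → IsClique Q → (∀ x → x ∈ X → Q x) →
    (p q : Fin n) → p ≢ q → p ∈ B → Q p → q ∈ B → Q q → B ∪ X ≡ B
  block-absorbs-clique B X Q (_ , _ , maximal) clB clQ X⊆Q p q p≢q pB Qp qB Qq =
    maximal (B ∪ X) (p⊆p∪q X)
      (twoCliques-noCutVertex (B ∪ X) (_∈ B) Q cover (λ x → p⊆p∪q X) clB clQ
         p q p≢q pB Qp qB Qq)
    where
    cover : ∀ x → x ∈ B ∪ X → x ∈ B ⊎ Q x
    cover x x∈ with x∈p∪q⁻ B X x∈
    ... | inj₁ xB = inj₁ xB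
    ... | inj₂ xX = inj₂ (X⊆Q x xX)

  -- Two distinct clique blocks share at most one vertex: each absorbs the other.
  cliqueBlocks-separated : (B B′ : Subset n) → IsBlock G B → IsBlock G B′ →
    IsClique (_∈ B) → IsClique (_∈ B′) →
    (p q : Fin n) → p ≢ q → p ∈ B → p ∈ B′ → q ∈ B → q ∈ B′ → B ≡ B′
  cliqueBlocks-separated B B′ blockB blockB′ clB clB′ p q p≢q pB pB′ qB qB′ =
    begin
      B       ≡⟨ sym (block-absorbs-clique B B′ (_∈ B′) blockB clB clB′ (λ _ x∈ → x∈)
                        p q p≢q pB pB′ qB qB′) ⟩
      B ∪ B′  ≡⟨ ∪-comm B B′ ⟩
      B′ ∪ B  ≡⟨ block-absorbs-clique B′ B (_∈ B) blockB′ clB′ clB (λ _ x∈ → x∈)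
                   p q p≢q pB′ pB qB′ qB ⟩
      B′      ∎
    where open ≡-Reasoning

  module _ (adj-sym : ∀ {x y} → Adj G x y → Adj G y x) where

    triangle-clique : ∀ {p q w} → Adj G p q → Adj G p w → Adj G q w →
      IsClique (λ x → x ≡ p ⊎ x ≡ q ⊎ x ≡ w)
    triangle-clique pq pw qw = clique
      where
      clique : IsClique _
      clique _ _ (inj₁ refl)        (inj₁ refl)        x≢y = ⊥-elim (x≢y refl)
      clique _ _ (inj₁ refl)        (inj₂ (inj₁ refl)) _   = pq
      clique _ _ (inj₁ refl)        (inj₂ (inj₂ refl)) _   = pw
      clique _ _ (inj₂ (inj₁ refl)) (inj₁ refl)        _   = adj-sym pq
      clique _ _ (inj₂ (inj₁ refl)) (inj₂ (inj₁ refl)) x≢y = ⊥-elim (x≢y refl)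
      clique _ _ (inj₂ (inj₁ refl)) (inj₂ (inj₂ refl)) _   = qw
      clique _ _ (inj₂ (inj₂ refl)) (inj₁ refl)        _   = adj-sym pw
      clique _ _ (inj₂ (inj₂ refl)) (inj₂ (inj₁ refl)) _   = adj-sym qw
      clique _ _ (inj₂ (inj₂ refl)) (inj₂ (inj₂ refl)) x≢y = ⊥-elim (x≢y refl)

    -- Absorption: a vertex adjacent to two distinct vertices of a clique block
    -- belongs to it, since the triangle they span is absorbed by the block.
    cliqueBlock-absorbs : (B : Subset n) → IsBlock G B → IsClique (_∈ B) →
      (p q w : Fin n) → p ∈ B → q ∈ B → p ≢ q → Adj G p w → Adj G q w → w ∈ B
    cliqueBlock-absorbs B blockB clB p q w pB qB p≢q pw qw =
      subst (w ∈_) B∪w≡B (x∈p∪q⁺ (inj₂ (x∈⁅x⁆ w)))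
      where
      B∪w≡B : B ∪ ⁅ w ⁆ ≡ B
      B∪w≡B = block-absorbs-clique B ⁅ w ⁆ _ blockB clB
                (triangle-clique (clB p q pB qB p≢q) pw qw)
                (λ x x∈ → inj₂ (inj₂ (x∈⁅y⁆⇒x≡y w x∈)))
                p q p≢q pB (inj₁ refl) qB (inj₂ (inj₁ refl))

simple-adj-sym : ∀ {n} {G : Graph n} → IsSimple G → ∀ {x y} → Adj G x y → Adj G y x
simple-adj-sym {G = G} (symmetric , _) {x} {y} xy = trans (symmetric y x) xy

laterNeighbours-adjacent : ∀ {n} (G : Graph n) → IsSimple G → IsBEO G →
  ∀ {v a b} → v < a → v < b → a ≢ b → Adj G v a → Adj G v b → Adj G a b
laterNeighbours-adjacent G simple beo {v} {a} {b} v<a v<b a≢b va vb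
  with FinP.<-cmp a b
... | tri< a<b _ _ = beo v a b v<a a<b va vb
... | tri≈ _ a≡b _ = ⊥-elim (a≢b a≡b)
... | tri> _ _ b<a = simple-adj-sym simple (beo v b a v<b b<a vb va)

-- If v is the last vertex of a clique block B, then F u = v for every other
-- u ∈ B: a neighbour w of u after v would be a later neighbour of u, hence
-- adjacent to v, hence absorbed into B, contradicting the maximality of v.
lastOfBlock-isF : ∀ {m} (G : Graph (suc m)) → IsSimple G → IsBEO G →
  (B : Subset (suc m)) → IsBlock G B → IsClique G (_∈ B) →
  (v : Fin (suc m)) → v ∈ B → (∀ u → u ∈ B → ¬ v < u) →
  ∀ u → u ∈ B → u ≢ v → F G u ≡ v
lastOfBlock-isF G simple beo B blockB clB v vB vLast u uB u≢v =
  F-largestNeighbour G u v u<v uv noLater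
  where
  u<v : u < v
  u<v = FinP.≤∧≢⇒< (≮⇒≥ (vLast u uB)) u≢v
  uv : Adj G u v
  uv = clB u v uB vB u≢v
  noLater : ∀ w → Adj G u w → ¬ v < w
  noLater w uw v<w = vLast w wB v<w
    where
    wB : w ∈ B
    wB = cliqueBlock-absorbs G (simple-adj-sym simple) B blockB clB u v w uB vB u≢v
           uw (beo u v w u<v v<w uv uw)

-- If v lies in distinct clique blocks B and B′ and B has a vertex after v,
-- then v is the last vertex of B′: a vertex u′ ∈ B′ after v would be adjacent
-- (or equal) to the vertex u ∈ B after v, hence lie in B, so that B and B′
-- would share the two vertices v and u′.
lastInOtherBlock : ∀ {n} (G : Graph n) → IsSimple G → IsBEO G →
  (B B′ : Subset n) → IsBlock G B → IsBlock G B′ → B ≢ B′ →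
  IsClique G (_∈ B) → IsClique G (_∈ B′) →
  (v : Fin n) → v ∈ B → v ∈ B′ → (u : Fin n) → u ∈ B → v < u →
  ∀ u′ → u′ ∈ B′ → ¬ v < u′
lastInOtherBlock G simple beo B B′ blockB blockB′ B≢B′ clB clB′ v vB vB′ u uB v<u u′ u′B′ v<u′ =
  B≢B′ (cliqueBlocks-separated G B B′ blockB blockB′ clB clB′
          u′ v (FinP.<⇒≢ v<u′ ∘ sym) (u′∈B (u ≟ u′)) u′B′ vB vB′)
  where
  vu : Adj G v u
  vu = clB v u vB uB (FinP.<⇒≢ v<u)
  vu′ : Adj G v u′
  vu′ = clB′ v u′ vB′ u′B′ (FinP.<⇒≢ v<u′)
  u′∈B : Dec (u ≡ u′) → u′ ∈ B
  u′∈B (yes refl) = uB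
  u′∈B (no u≢u′)  = cliqueBlock-absorbs G (simple-adj-sym simple) B blockB clB
                      u v u′ uB vB (FinP.<⇒≢ v<u ∘ sym)
                      (laterNeighbours-adjacent G simple beo v<u v<u′ u≢u′ vu vu′) vu′

-- Either v is the last vertex of B, or some vertex of B comes after v and
-- then v is the last vertex of B′; in both cases lastOfBlock-isF applies.
lemma3 : (m : ℕ) (G : Graph (suc m)) → IsSimple G → IsBlockGraph G → IsBEO G →
    (B B′ : Subset (suc m)) → IsBlock G B → IsBlock G B′ → B ≢ B′ →
    (v : Fin (suc m)) → v ∈ B → v ∈ B′ →
    (∀ u → u ∈ B → u ≢ v → F G u ≡ v) ⊎ (∀ u → u ∈ B′ → u ≢ v → F G u ≡ v)
lemma3 m G simple (_ , blocksComplete) beo B B′ blockB blockB′ B≢B′ v vB vB′ =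
  byLastness (FinP.any? (λ u → (u ∈? B) ×-dec (v FinP.<? u)))
  where
  clB : IsClique G (_∈ B)
  clB = blocksComplete B blockB
  clB′ : IsClique G (_∈ B′)
  clB′ = blocksComplete B′ blockB′
  byLastness : Dec (∃ λ u → u ∈ B × v < u) →
    (∀ u → u ∈ B → u ≢ v → F G u ≡ v) ⊎ (∀ u → u ∈ B′ → u ≢ v → F G u ≡ v)
  byLastness (no noneAfter) =
    inj₁ (lastOfBlock-isF G simple beo B blockB clB v vB
            (λ u uB v<u → noneAfter (u , uB , v<u)))
  byLastness (yes (u , uB , v<u)) =
    inj₂ (lastOfBlock-isF G simple beo B′ blockB′ clB′ v vB′
            (lastInOtherBlock G simple beo B B′ blockB blockB′ B≢B′ clB clB′ v vB vB′ u uB v<u))
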